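{- Let $t\geq 2$ and $r\geq 0$ be integers, let $n$ be an integer with $n\ge t+2r$, and let $\mathcal{A},\mathcal{B}\subset 2^{[n]}$ be cross $t$-intersecting families. Let $1\leq i<j\leq n$. If $s_{ij}(\mathcal{A})=s_{ij}(\mathcal{B})=\mathcal{F}_r^t$, then $\mathcal{A}=\mathcal{B}\cong\mathcal{F}_r^t$.
   Context: $[n]=\{1,\dots,n\}$. Families $\mathcal{A},\mathcal{B}\subset 2^{[n]}$ are cross $t$-intersecting if $|A\cap B|\geq t$ for all $A\in\mathcal{A}$, $B\in\mathcal{B}$. $\mathcal{F}^t_r=\{F\subset[n]: |F\cap[t+2r]|\geq t+r\}$. Shifting: for a family $\mathcal{F}\subset 2^{[n]}$, $F\in\mathcal{F}$ and $1\le i<j\le n$, let $s_{ij}(F)=(F\setminus\{j\})\cup\{i\}$ if $F\cap\{i,j\}=\{j\}$ and $(F\setminus\{j\})\cup\{i\}\notin\mathcal{F}$, and $s_{ij}(F)=F$ otherwise; then $s_{ij}(\mathcal{F})=\{s_{ij}(F):F\in\mathcal{F}\}$. Two families $\mathcal{G}_1,\mathcal{G}_2\subset 2^{[n]}$ are isomorphic, $\mathcal{G}_1\cong\mathcal{G}_2$, if there is a permutation $\sigma$ of $[n]$ with $\mathcal{G}_1=\{\{\sigma(k):k\in G\}:G\in\mathcal{G}_2\}$. -}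

module Defs where

open import Data.Bool using (Bool; true; false; not; _∧_; if_then_else_)
open import Data.Nat using (ℕ; _+_; _*_; _≤_; _<ᵇ_)
open import Data.Fin using (Fin; toℕ)
open import Data.Fin.Subset using (Subset; _∩_; ∣_∣; inside; outside)
open import Data.Fin.Permutation using (Permutation′; _⟨$⟩ʳ_; _⟨$⟩ˡ_)
open import Data.Vec using (lookup; tabulate; _[_]≔_)
open import Data.Product using (Σ; _×_; ∃)
open import Relation.Binary.PropositionalEquality using (_≡_)

-- A family 𝓕 ⊆ 2^[n] is given by its characteristic function
-- (the ground set [n] is modelled by Fin n, subsets by Subset n).
Family : ℕ → Set
Family n = Subset n → Bool

infix 4 _∈ᶠ_
_∈ᶠ_ : ∀ {n} → Subset n → Family n → Set
F ∈ᶠ 𝓕 = 𝓕 F ≡ true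

_≐_ : ∀ {n} → Family n → Family n → Set
𝓐 ≐ 𝓑 = ∀ F → 𝓐 F ≡ 𝓑 F

CrossIntersecting : ∀ {n} → ℕ → Family n → Family n → Set
CrossIntersecting t 𝓐 𝓑 =
  ∀ A B → A ∈ᶠ 𝓐 → B ∈ᶠ 𝓑 → t ≤ ∣ A ∩ B ∣

-- the initial segment [m] = {1,…,m} inside [n] (Fin index k ↔ element k+1)
initSeg : ∀ n → ℕ → Subset n
initSeg n m = tabulate (λ k → toℕ k <ᵇ m)

InF : ∀ n → ℕ → ℕ → Subset n → Set
InF n t r F = t + r ≤ ∣ F ∩ initSeg n (t + 2 * r) ∣

swapIn : ∀ {n} → Fin n → Fin n → Subset n → Subset n
swapIn i j F = (F [ j ]≔ outside) [ i ]≔ inside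

shiftSet : ∀ {n} → Fin n → Fin n → Family n → Subset n → Subset n
shiftSet i j 𝓕 F =
  if not (lookup F i) ∧ lookup F j ∧ not (𝓕 (swapIn i j F))
  then swapIn i j F else F

InShift : ∀ {n} → Fin n → Fin n → Family n → Subset n → Set
InShift i j 𝓕 G = ∃ λ F → F ∈ᶠ 𝓕 × shiftSet i j 𝓕 F ≡ G

-- image of a subset under a permutation σ : {σ(k) : k ∈ G}
-- (x lies in σ(G) iff σ⁻¹(x) ∈ G)
permImage : ∀ {n} → Permutation′ n → Subset n → Subset n
permImage σ G = tabulate (λ x → lookup G (σ ⟨$⟩ˡ x))

Isomorphic : ∀ {n} → Family n → (Subset n → Set) → Set
Isomorphic {n} 𝓖₁ 𝓖₂ = Σ (Permutation′ n) λ σ →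
  ∀ H → (H ∈ᶠ 𝓖₁ → ∃ λ G → 𝓖₂ G × H ≡ permImage σ G)
      × ((∃ λ G → 𝓖₂ G × H ≡ permImage σ G) → H ∈ᶠ 𝓖₁)

-- Call F movable if j ∈ F ∌ i, and raise F = (F ∖ {j}) ∪ {i}.  Knowing s_ij(X) = 𝓖
-- fixes X on sets containing both or neither of i, j, and fixes the meet and join
-- of the memberships of F and raise F; so X is determined except on ambiguous pairs
-- (F ∉ 𝓖 ∋ raise F), of which X contains exactly one member.  If X makes the same
-- choice o on every ambiguous pair, X is 𝓖 or its transpose (module Shifting).
-- For 𝓖 = 𝓕^t_r, ambiguous sets have i ∈ T = [t+2r], j ∉ T and |F ∩ T| = t+r−1.
-- Cross t-intersection forces 𝓐 at F and 𝓑 at K to choose alike when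
-- |F ∩ raise K| < t (relay); such a K exists for ambiguous F, H differing in fewer
-- than t points of T (link), and one-point exchanges inside T connect any two
-- ambiguous sets.  So 𝓐 and 𝓑 make one common choice (module Segment), and the
-- theorem follows.

module Submission where

open import Defs
open import Data.Bool using (Bool; true; false; not; _∧_; _∨_; if_then_else_)
open import Data.Bool.Properties using (¬-not; ∧-zeroʳ; ∧-idem; ∧-comm; ∧-identityʳ; ∧-inverseʳ)
import Data.Bool as B
open import Data.Nat using (ℕ; zero; suc; _+_; _*_; _≤_; _<_; _<ᵇ_; _≤?_; z≤n; s≤s)
open import Data.Nat.Properties hiding (_≟_)
open import Data.Nat.Tactic.RingSolver using (solve-∀)
open import Data.Fin using (Fin; zero; suc; toℕ; _≟_) renaming (_<_ to _<ᶠ_)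
import Data.Fin.Properties as Fin
open import Data.Fin.Subset using (Subset; _∩_; ∣_∣; inside; outside)
open import Data.Fin.Subset.Properties using (∩-comm; anySubset?)
open import Data.Fin.Permutation using (Permutation′; flip; id; transpose; inverseˡ; inverseʳ; _⟨$⟩ʳ_; _⟨$⟩ˡ_)
import Data.Fin.Permutation.Components as PC
open import Data.Vec using ([]; _∷_; lookup; tabulate; _[_]≔_)
open import Data.Vec.Properties using (lookup∘update; lookup∘update′; lookup∘tabulate; tabulate∘lookup; tabulate-cong; lookup-zipWith)
open import Data.Product using (∃; _×_; _,_; proj₁; proj₂)
open import Data.Sum using (_⊎_; inj₁; inj₂)
open import Data.Empty using (⊥; ⊥-elim)
open import Relation.Nullary using (¬_; yes; no; Dec; does)
open import Relation.Nullary.Decidable using (_×-dec_; dec-true; dec-false)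
open import Relation.Binary.PropositionalEquality
open import Function using (_∘_)
open import Function.Bundles using (_⇔_; mk⇔; Equivalence)
import Function.Properties.Equivalence as ⇔
open import Algebra.Properties.CommutativeSemigroup +-commutativeSemigroup using (x∙yz≈y∙xz)

true≢false : ¬ true ≡ false
true≢false ()

∧-⇔ : ∀ {x y} → x ∧ y ≡ true ⇔ (x ≡ true × y ≡ true)
∧-⇔ {true} {true} = mk⇔ (λ _ → refl , refl) (λ _ → refl)
∧-⇔ {true} {false} = mk⇔ (λ ()) (λ ())
∧-⇔ {false} = mk⇔ (λ ()) (λ ())

∨-⇔ : ∀ {x y} → x ∨ y ≡ true ⇔ (x ≡ true ⊎ y ≡ true)
∨-⇔ {true} = mk⇔ (λ _ → inj₁ refl) (λ _ → refl)
∨-⇔ {false} {true} = mk⇔ (λ _ → inj₂ refl) (λ _ → refl)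
∨-⇔ {false} {false} = mk⇔ (λ ()) (λ { (inj₁ ()) ; (inj₂ ()) })

bool-≡ : ∀ {Q : Set} {x y : Bool} → (x ≡ true ⇔ Q) → (y ≡ true ⇔ Q) → x ≡ y
bool-≡ {x = true}  {true}  _ _ = refl
bool-≡ {x = true}  {false} x⇔ y⇔ = sym (Equivalence.from y⇔ (Equivalence.to x⇔ refl))
bool-≡ {x = false} {true}  x⇔ y⇔ = Equivalence.from x⇔ (Equivalence.to y⇔ refl)
bool-≡ {x = false} {false} _ _ = refl

-- A pair (x, y) is pinned down by its meet a and join b up to swapping; the
-- swap is visible only when (a, b) = (false, true), and then x decides it.
pair-standard : ∀ x y {a b} → x ∧ y ≡ a → x ∨ y ≡ b →
  (a ≡ false → b ≡ true → x ≡ false) → x ≡ a × y ≡ b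
pair-standard true  true  refl refl _ = refl , refl
pair-standard true  false refl refl x≡false with () ← x≡false refl refl
pair-standard false true  refl refl _ = refl , refl
pair-standard false false refl refl _ = refl , refl

pair-swapped : ∀ x y {a b} → x ∧ y ≡ a → x ∨ y ≡ b →
  (a ≡ false → b ≡ true → x ≡ true) → x ≡ b × y ≡ a
pair-swapped true  true  refl refl _ = refl , refl
pair-swapped true  false refl refl _ = refl , refl
pair-swapped false true  refl refl x≡true with () ← x≡true refl refl
pair-swapped false false refl refl _ = refl , refl

complementary : ∀ x y → x ∧ y ≡ false → x ∨ y ≡ true → y ≡ not x
complementary true  false _ _ = refl
complementary false true  _ _ = refl

if-view : ∀ {A : Set} (c : Bool) (a b : A) →
  (if c then a else b) ≡ b ⊎ (c ≡ true × (if c then a else b) ≡ a)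
if-view true  a b = inj₂ (refl , refl)
if-view false a b = inj₁ refl

apart : ∀ {A : Set} (f : A → Bool) {x y} → f x ≡ true → f y ≡ false → ¬ x ≡ y
apart f fx fy refl = true≢false (trans (sym fx) fy)

does⇔ : ∀ {P : Set} (d : Dec P) → does d ≡ true ⇔ P
does⇔ (yes p) = mk⇔ (λ _ → p) (λ _ → refl)
does⇔ (no ¬p) = mk⇔ (λ ()) (λ p → ⊥-elim (¬p p))

Pred : ℕ → Set
Pred n = Fin n → Bool

infixl 7 _⊓_ _∖_
_⊓_ _∖_ : ∀ {n} → Pred n → Pred n → Pred n
(f ⊓ g) k = f k ∧ g k
(f ∖ g) k = f k ∧ not (g k)

infix 4 _⊆_
_⊆_ : ∀ {n} → Pred n → Pred n → Set
f ⊆ g = ∀ k → f k ≡ true → g k ≡ true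

bit : Bool → ℕ
bit true  = 1
bit false = 0

bit≤1 : ∀ b → bit b ≤ 1
bit≤1 true  = s≤s z≤n
bit≤1 false = z≤n

count : ∀ {n} → Pred n → ℕ
count {zero}  f = 0
count {suc n} f = bit (f zero) + count (f ∘ suc)

count-cong : ∀ {n} {f g : Pred n} → (∀ k → f k ≡ g k) → count f ≡ count g
count-cong {zero}  f≗g = refl
count-cong {suc n} f≗g = cong₂ _+_ (cong bit (f≗g zero)) (count-cong (f≗g ∘ suc))

count-empty : ∀ n → count {n} (λ _ → false) ≡ 0
count-empty zero    = refl
count-empty (suc n) = count-empty n

count-split : ∀ {n} (f g : Pred n) → count f ≡ count (f ⊓ g) + count (f ∖ g)
count-split {zero}  f g = refl
count-split {suc n} f g with f zero | g zero
... | true  | true  = cong suc (count-split (f ∘ suc) (g ∘ suc))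
... | true  | false = trans (cong suc (count-split (f ∘ suc) (g ∘ suc))) (sym (+-suc _ _))
... | false | _     = count-split (f ∘ suc) (g ∘ suc)

count-mono : ∀ {n} {f g : Pred n} → f ⊆ g → count f ≤ count g
count-mono {zero}  f⊆g = z≤n
count-mono {suc n} {f} {g} f⊆g with f zero in f₀ | g zero in g₀
... | true  | true  = s≤s (count-mono (f⊆g ∘ suc))
... | true  | false with () ← trans (sym (f⊆g zero f₀)) g₀
... | false | true  = m≤n⇒m≤1+n (count-mono (f⊆g ∘ suc))
... | false | false = count-mono (f⊆g ∘ suc)

count-witness : ∀ {n} (f : Pred n) → 0 < count f → ∃ λ k → f k ≡ true
count-witness {suc n} f pos with f zero in f₀
... | true  = zero , f₀
... | false with count-witness (f ∘ suc) pos
...   | k , fk = suc k , fk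

count-delete : ∀ {n} {f g : Pred n} (a : Fin n) → (∀ k → ¬ k ≡ a → f k ≡ g k) →
  g a ≡ false → count f ≡ bit (f a) + count g
count-delete {suc n} {f} {g} zero f≗g ga rewrite ga =
  cong (bit (f zero) +_) (count-cong (λ k → f≗g (suc k) (λ ())))
count-delete {suc n} {f} {g} (suc a) f≗g ga
  rewrite f≗g zero (λ ())
        | count-delete {f = f ∘ suc} {g = g ∘ suc} a (λ k k≢a → f≗g (suc k) (k≢a ∘ Fin.suc-injective)) ga
  = x∙yz≈y∙xz (bit (g zero)) (bit (f (suc a))) _

count-exchange : ∀ {n} {f g : Pred n} (a b : Fin n) →
  (∀ k → ¬ k ≡ a → ¬ k ≡ b → f k ≡ g k) →
  f a ≡ false → g a ≡ true → f b ≡ true → g b ≡ false → count f ≡ count g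
count-exchange {f = f} {g} a b f≗g fa ga fb gb = begin
  count f              ≡⟨ count-delete b f≗f⊓g (trans (cong (f b ∧_) gb) (∧-zeroʳ (f b))) ⟩
  bit (f b) + count (f ⊓ g) ≡⟨ cong (λ x → bit x + count (f ⊓ g)) (trans fb (sym ga)) ⟩
  bit (g a) + count (f ⊓ g) ≡⟨ count-delete a g≗f⊓g (cong (_∧ g a) fa) ⟨
  count g              ∎
  where
  open ≡-Reasoning
  f≗f⊓g : ∀ k → ¬ k ≡ b → f k ≡ f k ∧ g k
  f≗f⊓g k k≢b with k ≟ a
  ... | yes refl = trans fa (cong (_∧ g a) (sym fa))
  ... | no k≢a   = trans (sym (∧-idem (f k))) (cong (f k ∧_) (f≗g k k≢a k≢b))
  g≗f⊓g : ∀ k → ¬ k ≡ a → g k ≡ f k ∧ g k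
  g≗f⊓g k k≢a with k ≟ b
  ... | yes refl = trans gb (sym (trans (cong (f b ∧_) gb) (∧-zeroʳ (f b))))
  ... | no k≢b   = trans (sym (∧-idem (g k))) (cong (_∧ g k) (sym (f≗g k k≢a k≢b)))

count-balance : ∀ {n} (f g : Pred n) → count f ≡ count g → count (f ∖ g) ≡ count (g ∖ f)
count-balance f g #f≡#g = +-cancelˡ-≡ (count (f ⊓ g)) _ _ (begin
  count (f ⊓ g) + count (f ∖ g) ≡⟨ count-split f g ⟨
  count f                       ≡⟨ #f≡#g ⟩
  count g                       ≡⟨ count-split g f ⟩
  count (g ⊓ f) + count (g ∖ f) ≡⟨ cong (_+ count (g ∖ f)) (count-cong (λ k → ∧-comm (g k) (f k))) ⟩
  count (f ⊓ g) + count (g ∖ f) ∎)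
  where open ≡-Reasoning

count-initial : ∀ {n} a → a ≤ n → count {n} (λ k → toℕ k <ᵇ a) ≡ a
count-initial {zero}  zero    _         = refl
count-initial {suc n} zero    _         = count-empty (suc n)
count-initial {suc n} (suc a) (s≤s a≤n) = cong suc (count-initial a a≤n)

_◂_ : ∀ {n} → Bool → Pred n → Pred (suc n)
(b ◂ h) zero    = b
(b ◂ h) (suc k) = h k

head-choice : ∀ {n} (f g : Pred (suc n)) m → f ⊆ g → count f ≤ m → m ≤ count g →
  ∃ λ b → ∃ λ m′ → (f zero ≡ true → b ≡ true) × (b ≡ true → g zero ≡ true) ×
    bit b + m′ ≡ m × count (f ∘ suc) ≤ m′ × m′ ≤ count (g ∘ suc)
head-choice f g m f⊆g lo hi with f zero in f₀ | g zero in g₀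
head-choice f g (suc m) f⊆g (s≤s lo) (s≤s hi) | true | true =
  true , m , (λ _ → refl) , (λ _ → refl) , refl , lo , hi
... | true | false with () ← trans (sym (f⊆g zero f₀)) g₀
... | false | false = false , m , (λ ()) , (λ ()) , refl , lo , hi
... | false | true with m ≤? count (g ∘ suc)
...   | yes m≤ = false , m , (λ ()) , (λ ()) , refl , lo , m≤
head-choice f g (suc m) f⊆g lo hi | false | true | no m≰ =
  true , m , (λ _ → refl) , (λ _ → refl) , refl ,
  ≤-pred (≤-trans (s≤s (count-mono (f⊆g ∘ suc))) (≰⇒> m≰)) , ≤-pred hi
head-choice f g zero f⊆g lo hi | false | true | no m≰ = ⊥-elim (m≰ z≤n)

count-between : ∀ {n} (f g : Pred n) m → f ⊆ g → count f ≤ m → m ≤ count g →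
  ∃ λ h → f ⊆ h × h ⊆ g × count h ≡ m
count-between {zero} f g m _ _ m≤0 = f , (λ _ x → x) , (λ ()) , sym (n≤0⇒n≡0 m≤0)
count-between {suc n} f g m f⊆g lo hi
  with head-choice f g m f⊆g lo hi
... | b , m′ , f₀⇒b , b⇒g₀ , bm′≡m , lo′ , hi′
  with count-between (f ∘ suc) (g ∘ suc) m′ (f⊆g ∘ suc) lo′ hi′
... | h , f⊆h , h⊆g , #h≡m′ =
  b ◂ h , (λ { zero → f₀⇒b ; (suc k) → f⊆h k }) , (λ { zero → b⇒g₀ ; (suc k) → h⊆g k }) ,
  trans (cong (bit b +_) #h≡m′) bm′≡m

difference-pinned : ∀ {n} {f g : Pred n} (h : Pred n) → f ∖ h ⊆ g → g ⊆ f →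
  ∀ k → (g ∖ h) k ≡ (f ∖ h) k
difference-pinned {f = f} {g} h f∖h⊆g g⊆f k = pinned (h k) (f k) (g k) (f∖h⊆g k) (g⊆f k)
  where
  pinned : ∀ c x y → (x ∧ not c ≡ true → y ≡ true) → (y ≡ true → x ≡ true) → y ∧ not c ≡ x ∧ not c
  pinned true  x     y     _ _ = trans (∧-zeroʳ y) (sym (∧-zeroʳ x))
  pinned false true  true  _ _ = refl
  pinned false false false _ _ = refl
  pinned false true  false p _ with () ← p refl
  pinned false false true  _ q with () ← q refl

meet-superset : ∀ {n} {f g : Pred n} → g ⊆ f → ∀ k → (f ⊓ g) k ≡ g k
meet-superset {f = f} {g} g⊆f k = meet (f k) (g k) (g⊆f k)
  where
  meet : ∀ x y → (y ≡ true → x ≡ true) → x ∧ y ≡ y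
  meet true  y     _ = refl
  meet false false _ = refl
  meet false true  p with () ← p refl

subset-ext : ∀ {n} {u v : Subset n} → (∀ k → lookup u k ≡ lookup v k) → u ≡ v
subset-ext {u = u} {v} u≗v =
  trans (sym (tabulate∘lookup u)) (trans (tabulate-cong u≗v) (tabulate∘lookup v))

card-count : ∀ {n} (V : Subset n) → ∣ V ∣ ≡ count (lookup V)
card-count []          = refl
card-count (true ∷ V)  = cong suc (card-count V)
card-count (false ∷ V) = card-count V

card-∩ : ∀ {n} (V W : Subset n) → ∣ V ∩ W ∣ ≡ count (lookup V ⊓ lookup W)
card-∩ V W = trans (card-count (V ∩ W)) (count-cong (λ k → lookup-zipWith _∧_ k V W))

replace : ∀ {n} → Subset n → Fin n → Fin n → Subset n
replace H a b = (H [ b ]≔ outside) [ a ]≔ inside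

replace-a : ∀ {n} H {a b : Fin n} → lookup (replace H a b) a ≡ true
replace-a H {a} {b} = lookup∘update a (H [ b ]≔ outside) inside

replace-b : ∀ {n} H {a b : Fin n} → ¬ a ≡ b → lookup (replace H a b) b ≡ false
replace-b H {a} {b} a≢b =
  trans (lookup∘update′ (a≢b ∘ sym) (H [ b ]≔ outside) inside) (lookup∘update b H outside)

replace-other : ∀ {n} H {a b k : Fin n} → ¬ k ≡ a → ¬ k ≡ b → lookup (replace H a b) k ≡ lookup H k
replace-other H {a} {b} k≢a k≢b =
  trans (lookup∘update′ k≢a (H [ b ]≔ outside) inside) (lookup∘update′ k≢b H outside)

isomorphic-via : ∀ {n} {X : Family n} {P : Subset n → Set} (σ : Permutation′ n) →
  (∀ H → H ∈ᶠ X ⇔ P (permImage (flip σ) H)) → Isomorphic X P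
isomorphic-via {X = X} {P} σ X≅P = σ , λ H →
  (λ H∈X → permImage (flip σ) H , Equivalence.to (X≅P H) H∈X , sym (image-inverseʳ H)) ,
  (λ (G , PG , H≡σG) → Equivalence.from (X≅P H)
    (subst P (sym (trans (cong (permImage (flip σ)) H≡σG) (image-inverseˡ G))) PG))
  where
  image-inverseʳ : ∀ H → permImage σ (permImage (flip σ) H) ≡ H
  image-inverseʳ H = subset-ext (λ k → trans (lookup∘tabulate _ k)
    (trans (lookup∘tabulate _ (σ ⟨$⟩ˡ k)) (cong (lookup H) (inverseʳ σ))))
  image-inverseˡ : ∀ G → permImage (flip σ) (permImage σ G) ≡ G
  image-inverseˡ G = subset-ext (λ k → trans (lookup∘tabulate _ k)
    (trans (lookup∘tabulate _ (σ ⟨$⟩ʳ k)) (cong (lookup G) (inverseˡ σ))))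

cross-sym : ∀ {n t} {A B : Family n} → CrossIntersecting t A B → CrossIntersecting t B A
cross-sym {t = t} cross G K G∈B K∈A = subst (t ≤_) (cong ∣_∣ (∩-comm K G)) (cross K G K∈A G∈B)

module Shifting {n} (i j : Fin n) (i≢j : ¬ i ≡ j) where

  by-position : (P : Fin n → Set) → P i → P j → (∀ k → ¬ k ≡ i → ¬ k ≡ j → P k) → ∀ k → P k
  by-position P Pi Pj Pk k with k ≟ i | k ≟ j
  ... | yes refl | _        = Pi
  ... | no _     | yes refl = Pj
  ... | no k≢i   | no k≢j   = Pk k k≢i k≢j

  Movable : Subset n → Set
  Movable F = lookup F i ≡ false × lookup F j ≡ true

  raise lower : Subset n → Subset n
  raise F = replace F i j
  lower H = replace H j i

  raise-i : ∀ G → lookup (raise G) i ≡ true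
  raise-i G = replace-a G

  raise-j : ∀ G → lookup (raise G) j ≡ false
  raise-j G = replace-b G i≢j

  raise-other : ∀ G k → ¬ k ≡ i → ¬ k ≡ j → lookup (raise G) k ≡ lookup G k
  raise-other G k = replace-other G

  lower-i : ∀ H → lookup (lower H) i ≡ false
  lower-i H = replace-b H (i≢j ∘ sym)

  lower-j : ∀ H → lookup (lower H) j ≡ true
  lower-j H = replace-a H

  lower-other : ∀ H k → ¬ k ≡ i → ¬ k ≡ j → lookup (lower H) k ≡ lookup H k
  lower-other H k k≢i k≢j = replace-other H k≢j k≢i

  lower-movable : ∀ H → Movable (lower H)
  lower-movable H = lower-i H , lower-j H

  raise-lower : ∀ H → lookup H i ≡ true → lookup H j ≡ false → raise (lower H) ≡ H
  raise-lower H Hi Hj = subset-ext (by-position _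
    (trans (raise-i (lower H)) (sym Hi))
    (trans (raise-j (lower H)) (sym Hj))
    (λ k k≢i k≢j → trans (raise-other (lower H) k k≢i k≢j) (lower-other H k k≢i k≢j)))

  lower-raise : ∀ F → Movable F → lower (raise F) ≡ F
  lower-raise F (Fi , Fj) = subset-ext (by-position _
    (trans (lower-i (raise F)) (sym Fi))
    (trans (lower-j (raise F)) (sym Fj))
    (λ k k≢i k≢j → trans (lower-other (raise F) k k≢i k≢j) (raise-other F k k≢i k≢j)))

  raise-injective : ∀ {E F} → Movable E → Movable F → raise E ≡ raise F → E ≡ F
  raise-injective {E} {F} mE mF eq =
    trans (sym (lower-raise E mE)) (trans (cong lower eq) (lower-raise F mF))

  position : ∀ H → lookup H i ≡ lookup H j ⊎ Movable H ⊎ ∃ λ F → Movable F × H ≡ raise F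
  position H with lookup H i in Hi | lookup H j in Hj
  ... | true  | true  = inj₁ refl
  ... | false | false = inj₁ refl
  ... | false | true  = inj₂ (inj₁ (refl , refl))
  ... | true  | false = inj₂ (inj₂ (lower H , lower-movable H , sym (raise-lower H Hi Hj)))

  raise-∩ : ∀ {F K} → Movable F → Movable K → raise F ∩ K ≡ F ∩ raise K
  raise-∩ {F} {K} (Fi , Fj) (Ki , Kj) = subset-ext (λ k →
    trans (lookup-zipWith _∧_ k (raise F) K)
      (trans (pointwise k) (sym (lookup-zipWith _∧_ k F (raise K)))))
    where
    pointwise : ∀ k → lookup (raise F) k ∧ lookup K k ≡ lookup F k ∧ lookup (raise K) k
    pointwise = by-position _
      (trans (cong₂ _∧_ (raise-i F) Ki) (cong₂ _∧_ (sym Fi) (sym (raise-i K))))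
      (trans (cong₂ _∧_ (raise-j F) Kj) (cong₂ _∧_ (sym Fj) (sym (raise-j K))))
      (λ k k≢i k≢j → cong₂ _∧_ (raise-other F k k≢i k≢j) (sym (raise-other K k k≢i k≢j)))

  move-condition : ∀ {x y z} → not x ∧ y ∧ not z ≡ true → (x ≡ false × y ≡ true) × z ≡ false
  move-condition {false} {true} {false} _ = (refl , refl) , refl

  shift-cases : ∀ X F → shiftSet i j X F ≡ F ⊎
    (Movable F × X (raise F) ≡ false × shiftSet i j X F ≡ raise F)
  shift-cases X F with if-view (not (lookup F i) ∧ lookup F j ∧ not (X (raise F))) (raise F) F
  ... | inj₁ stays = inj₁ stays
  ... | inj₂ (condition , moves) with move-condition condition
  ...   | mF , x = inj₂ (mF , x , moves)

  shift-moves : ∀ X F → Movable F → X (raise F) ≡ false → shiftSet i j X F ≡ raise F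
  shift-moves X F (Fi , Fj) x rewrite Fi | Fj | x = refl

  shift-stays : ∀ X F → (Movable F → X (raise F) ≡ true) → shiftSet i j X F ≡ F
  shift-stays X F blocked with shift-cases X F
  ... | inj₁ stays = stays
  ... | inj₂ (mF , x , _) with () ← trans (sym (blocked mF)) x

  raised-i : ∀ {F G} → raise F ≡ G → lookup G i ≡ false → ⊥
  raised-i {F} refl Gi = true≢false (trans (sym (raise-i F)) Gi)

  raised-level : ∀ {F G} → raise F ≡ G → lookup G i ≡ lookup G j → ⊥
  raised-level {F} refl level = true≢false (trans (sym (raise-i F)) (trans level (raise-j F)))

  shift-level : ∀ X G → lookup G i ≡ lookup G j → InShift i j X G ⇔ G ∈ᶠ X
  shift-level X G level = mk⇔ to from
    where
    to : InShift i j X G → G ∈ᶠ X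
    to (F , F∈X , sF≡G) with shift-cases X F
    ... | inj₁ stays           = subst (_∈ᶠ X) (trans (sym stays) sF≡G) F∈X
    ... | inj₂ (_ , _ , moves) = ⊥-elim (raised-level (trans (sym moves) sF≡G) level)
    from : G ∈ᶠ X → InShift i j X G
    from G∈X = G , G∈X , shift-stays X G
      (λ (Gi , Gj) → ⊥-elim (true≢false (trans (sym Gj) (trans (sym level) Gi))))

  shift-movable : ∀ X F → Movable F → InShift i j X F ⇔ (F ∈ᶠ X × raise F ∈ᶠ X)
  shift-movable X F mF@(Fi , _) = mk⇔ to from
    where
    to : InShift i j X F → F ∈ᶠ X × raise F ∈ᶠ X
    to (E , E∈X , sE≡F) with shift-cases X E
    ... | inj₂ (_ , _ , moves) = ⊥-elim (raised-i (trans (sym moves) sE≡F) Fi)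
    ... | inj₁ stays with trans (sym stays) sE≡F
    ...   | refl = E∈X , ¬-not (λ x → raised-i (trans (sym (shift-moves X E mF x)) stays) Fi)
    from : F ∈ᶠ X × raise F ∈ᶠ X → InShift i j X F
    from (F∈X , rF∈X) = F , F∈X , shift-stays X F (λ _ → rF∈X)

  shift-raised : ∀ X F → Movable F → InShift i j X (raise F) ⇔ (F ∈ᶠ X ⊎ raise F ∈ᶠ X)
  shift-raised X F mF = mk⇔ to from
    where
    to : InShift i j X (raise F) → F ∈ᶠ X ⊎ raise F ∈ᶠ X
    to (E , E∈X , sE≡rF) with shift-cases X E
    ... | inj₁ stays = inj₂ (subst (_∈ᶠ X) (trans (sym stays) sE≡rF) E∈X)
    ... | inj₂ (mE , _ , moves) =
      inj₁ (subst (_∈ᶠ X) (raise-injective mE mF (trans (sym moves) sE≡rF)) E∈X)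
    stays-raised : shiftSet i j X (raise F) ≡ raise F
    stays-raised = shift-stays X (raise F) (λ (rFi , _) → ⊥-elim (raised-i {F} refl rFi))
    from : F ∈ᶠ X ⊎ raise F ∈ᶠ X → InShift i j X (raise F)
    from (inj₂ rF∈X) = raise F , rF∈X , stays-raised
    from (inj₁ F∈X) with X (raise F) in x
    ... | true  = raise F , x , stays-raised
    ... | false = F , F∈X , shift-moves X F mF x

  Ambiguous : Family n → Subset n → Set
  Ambiguous 𝓖 F = Movable F × 𝓖 F ≡ false × 𝓖 (raise F) ≡ true

  ambiguous? : ∀ 𝓖 F → Dec (Ambiguous 𝓖 F)
  ambiguous? 𝓖 F = (lookup F i B.≟ false ×-dec lookup F j B.≟ true) ×-dec
                   (𝓖 F B.≟ false ×-dec 𝓖 (raise F) B.≟ true)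

  τ : Subset n → Subset n
  τ = permImage (flip (transpose i j))

  τ-lookup : ∀ H k → lookup (τ H) k ≡ lookup H (PC.transpose i j k)
  τ-lookup H k = lookup∘tabulate _ k

  τ-i : ∀ H → lookup (τ H) i ≡ lookup H j
  τ-i H rewrite τ-lookup H i | dec-true (i ≟ i) refl = refl

  τ-j : ∀ H → lookup (τ H) j ≡ lookup H i
  τ-j H rewrite τ-lookup H j | dec-false (j ≟ i) (i≢j ∘ sym) | dec-true (j ≟ j) refl = refl

  τ-other : ∀ H k → ¬ k ≡ i → ¬ k ≡ j → lookup (τ H) k ≡ lookup H k
  τ-other H k k≢i k≢j rewrite τ-lookup H k | dec-false (k ≟ i) k≢i | dec-false (k ≟ j) k≢j = refl

  τ-level : ∀ H → lookup H i ≡ lookup H j → τ H ≡ H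
  τ-level H level = subset-ext (by-position _ (trans (τ-i H) (sym level)) (trans (τ-j H) level) (τ-other H))

  τ-movable : ∀ F → Movable F → τ F ≡ raise F
  τ-movable F (Fi , Fj) = subset-ext (by-position _
    (trans (τ-i F) (trans Fj (sym (raise-i F))))
    (trans (τ-j F) (trans Fi (sym (raise-j F))))
    (λ k k≢i k≢j → trans (τ-other F k k≢i k≢j) (sym (raise-other F k k≢i k≢j))))

  τ-raised : ∀ F → Movable F → τ (raise F) ≡ F
  τ-raised F (Fi , Fj) = subset-ext (by-position _
    (trans (τ-i (raise F)) (trans (raise-j F) (sym Fi)))
    (trans (τ-j (raise F)) (trans (raise-i F) (sym Fj)))
    (λ k k≢i k≢j → trans (τ-other (raise F) k k≢i k≢j) (raise-other F k k≢i k≢j)))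

  twist : Bool → Permutation′ n
  twist false = id
  twist true  = transpose i j

  module Shifted (X 𝓖 : Family n) (X↦𝓖 : ∀ G → InShift i j X G ⇔ G ∈ᶠ 𝓖) where

    level-agree : ∀ G → lookup G i ≡ lookup G j → X G ≡ 𝓖 G
    level-agree G level = bool-≡ (⇔.sym (shift-level X G level)) (⇔.sym (X↦𝓖 G))

    movable-meet : ∀ F → Movable F → X F ∧ X (raise F) ≡ 𝓖 F
    movable-meet F mF = bool-≡ (⇔.trans ∧-⇔ (⇔.sym (shift-movable X F mF))) (⇔.sym (X↦𝓖 F))

    movable-join : ∀ F → Movable F → X F ∨ X (raise F) ≡ 𝓖 (raise F)
    movable-join F mF = bool-≡ (⇔.trans ∨-⇔ (⇔.sym (shift-raised X F mF))) (⇔.sym (X↦𝓖 (raise F)))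

    ambiguous-complement : ∀ F → Ambiguous 𝓖 F → X (raise F) ≡ not (X F)
    ambiguous-complement F (mF , F∉ , rF∈) = complementary (X F) (X (raise F))
      (trans (movable-meet F mF) F∉) (trans (movable-join F mF) rF∈)

    pair-agrees : ∀ F → Movable F → (Ambiguous 𝓖 F → X F ≡ false) →
      X F ≡ 𝓖 F × X (raise F) ≡ 𝓖 (raise F)
    pair-agrees F mF omits = pair-standard (X F) (X (raise F)) (movable-meet F mF)
      (movable-join F mF) (λ F∉ rF∈ → omits (mF , F∉ , rF∈))

    pair-agrees-τ : ∀ F → Movable F → (Ambiguous 𝓖 F → X F ≡ true) →
      X F ≡ 𝓖 (τ F) × X (raise F) ≡ 𝓖 (τ (raise F))
    pair-agrees-τ F mF contains
      with pair-swapped (X F) (X (raise F)) (movable-meet F mF)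
             (movable-join F mF) (λ F∉ rF∈ → contains (mF , F∉ , rF∈))
    ... | XF , XrF = trans XF (cong 𝓖 (sym (τ-movable F mF))) ,
                     trans XrF (cong 𝓖 (sym (τ-raised F mF)))

    reconstruct-standard : (∀ F → Ambiguous 𝓖 F → X F ≡ false) → ∀ H → X H ≡ 𝓖 H
    reconstruct-standard omits H with position H
    ... | inj₁ level                  = level-agree H level
    ... | inj₂ (inj₁ mH)              = proj₁ (pair-agrees H mH (omits H))
    ... | inj₂ (inj₂ (F , mF , refl)) = proj₂ (pair-agrees F mF (omits F))

    reconstruct-swapped : (∀ F → Ambiguous 𝓖 F → X F ≡ true) → ∀ H → X H ≡ 𝓖 (τ H)
    reconstruct-swapped contains H with position H
    ... | inj₁ level                  = trans (level-agree H level) (cong 𝓖 (sym (τ-level H level)))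
    ... | inj₂ (inj₁ mH)              = proj₁ (pair-agrees-τ H mH (contains H))
    ... | inj₂ (inj₂ (F , mF , refl)) = proj₂ (pair-agrees-τ F mF (contains F))

    reconstruct : ∀ o → (∀ F → Ambiguous 𝓖 F → X F ≡ o) →
      ∀ H → X H ≡ 𝓖 (permImage (flip (twist o)) H)
    reconstruct false omits H =
      trans (reconstruct-standard omits H) (cong 𝓖 (subset-ext (λ k → sym (lookup∘tabulate _ k))))
    reconstruct true = reconstruct-swapped

  relay : ∀ t {X Y 𝓖 F K} → (∀ G → InShift i j X G ⇔ G ∈ᶠ 𝓖) → (∀ G → InShift i j Y G ⇔ G ∈ᶠ 𝓖) →
    CrossIntersecting t X Y → Ambiguous 𝓖 F → Ambiguous 𝓖 K → ∣ F ∩ raise K ∣ < t → X F ≡ Y K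
  relay t {X} {Y} {𝓖} {F} {K} X↦𝓖 Y↦𝓖 cross ambF ambK small with X F in xF
  ... | true  = sym (¬-not (λ yK → <⇒≱ small (cross F (raise K) xF (Y-raised yK))))
    where
    Y-raised : Y K ≡ false → raise K ∈ᶠ Y
    Y-raised yK = trans (Shifted.ambiguous-complement Y 𝓖 Y↦𝓖 K ambK) (cong not yK)
  ... | false = sym (¬-not (λ yK → <⇒≱ small (subst (t ≤_) same-size (cross (raise F) K X-raised yK))))
    where
    X-raised : raise F ∈ᶠ X
    X-raised = trans (Shifted.ambiguous-complement X 𝓖 X↦𝓖 F ambF) (cong not xF)
    same-size : ∣ raise F ∩ K ∣ ≡ ∣ F ∩ raise K ∣
    same-size = cong ∣_∣ (raise-∩ {F} {K} (proj₁ ambF) (proj₁ ambK))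

split-size : ∀ t₁ r → suc t₁ + 2 * r ≡ (t₁ + r) + suc r
split-size = solve-∀

-- Throughout, t = 1 + t₁, T = [t + 2r] is the initial segment, and
-- s = t₁ + r = t + r − 1 is the T-weight of an ambiguous set.
module Segment (t₁ r n : ℕ) (size : suc t₁ + 2 * r ≤ n) where

  t s : ℕ
  t = suc t₁
  s = t₁ + r

  T : Pred n
  T k = toℕ k <ᵇ (t + 2 * r)

  trace : Subset n → Pred n
  trace G = T ⊓ lookup G

  weight : Subset n → ℕ
  weight G = count (trace G)

  distance : Subset n → Subset n → ℕ
  distance F H = count (trace F ∖ trace H)

  self-distance : ∀ F → distance F F ≡ 0
  self-distance F = trans (count-cong (λ k → ∧-inverseʳ (trace F k))) (count-empty n)

  count-T : count T ≡ t + 2 * r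
  count-T = count-initial (t + 2 * r) size

  𝓕 : Family n
  𝓕 G = does (t + r ≤? weight G)

  in-𝓕 : ∀ G → G ∈ᶠ 𝓕 ⇔ t + r ≤ weight G
  in-𝓕 G = does⇔ (t + r ≤? weight G)

  InF⇔𝓕 : ∀ G → InF n t r G ⇔ G ∈ᶠ 𝓕
  InF⇔𝓕 G rewrite cong ∣_∣ (∩-comm G (initSeg n (t + 2 * r)))
                | card-∩ (initSeg n (t + 2 * r)) G
                | count-cong {f = lookup (initSeg n (t + 2 * r)) ⊓ lookup G} {g = trace G}
                    (λ k → cong (_∧ lookup G k) (lookup∘tabulate _ k))
    = ⇔.sym (in-𝓕 G)

  module AtPair (i j : Fin n) (i≢j : ¬ i ≡ j) where
    open Shifting i j i≢j

    weight-raise : ∀ F → Movable F → bit (T j) + weight (raise F) ≡ bit (T i) + weight F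
    weight-raise F (Fi , Fj) = begin
      bit (T j) + weight (raise F)            ≡⟨ cong (bit (T j) +_) raise-drops-i ⟩
      bit (T j) + (bit (T i) + weight′)       ≡⟨ x∙yz≈y∙xz (bit (T j)) (bit (T i)) weight′ ⟩
      bit (T i) + (bit (T j) + weight′)       ≡⟨ cong (bit (T i) +_) F-drops-j ⟨
      bit (T i) + weight F                    ∎
      where
      open ≡-Reasoning
      F′ : Subset n
      F′ = F [ j ]≔ outside
      weight′ : ℕ
      weight′ = count (trace F′)
      F-drops-j : weight F ≡ bit (T j) + weight′
      F-drops-j = trans
        (count-delete j (λ k k≢j → cong (T k ∧_) (sym (lookup∘update′ k≢j F outside)))
          (trans (cong (T j ∧_) (lookup∘update j F outside)) (∧-zeroʳ (T j))))
        (cong (λ b → bit b + weight′) (trans (cong (T j ∧_) Fj) (∧-identityʳ (T j))))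
      raise-drops-i : weight (raise F) ≡ bit (T i) + weight′
      raise-drops-i = trans
        (count-delete i (λ k k≢i → cong (T k ∧_) (lookup∘update′ k≢i F′ inside))
          (trans (cong (T i ∧_) (trans (lookup∘update′ i≢j F outside) Fi)) (∧-zeroʳ (T i))))
        (cong (λ b → bit b + weight′) (trans (cong (T i ∧_) (raise-i F)) (∧-identityʳ (T i))))

    ambiguous-ends : ∀ F → Ambiguous 𝓕 F → T i ≡ true × T j ≡ false
    ambiguous-ends F (mF , F∉ , rF∈) = ends (T i) (T j) (weight-raise F mF)
      (<-≤-trans (≰⇒> (λ F∈ → true≢false (trans (sym (Equivalence.from (in-𝓕 F) F∈)) F∉)))
                 (Equivalence.to (in-𝓕 (raise F)) rF∈))
      where
      ends : ∀ a b {w w′} → bit b + w′ ≡ bit a + w → w < w′ → a ≡ true × b ≡ false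
      ends true  false _  _    = refl , refl
      ends true  true  eq w<w′ = ⊥-elim (<-irrefl (sym (suc-injective eq)) w<w′)
      ends false false eq w<w′ = ⊥-elim (<-irrefl (sym eq) w<w′)
      ends false true  eq w<w′ = ⊥-elim (<-asym w<w′ (≤-reflexive eq))

    module Ends (Ti : T i ≡ true) (Tj : T j ≡ false) where

      raise-weight : ∀ F → Movable F → weight (raise F) ≡ suc (weight F)
      raise-weight F mF =
        subst₂ (λ a b → bit b + weight (raise F) ≡ bit a + weight F) Ti Tj (weight-raise F mF)

      ambiguous⇔ : ∀ F → Ambiguous 𝓕 F ⇔ (Movable F × weight F ≡ s)
      ambiguous⇔ F = mk⇔ to from
        where
        to : Ambiguous 𝓕 F → Movable F × weight F ≡ s
        to (mF , F∉ , rF∈) = mF , ≤-antisym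
          (≤-pred (≰⇒> (λ F∈ → true≢false (trans (sym (Equivalence.from (in-𝓕 F) F∈)) F∉))))
          (≤-pred (subst (suc s ≤_) (raise-weight F mF) (Equivalence.to (in-𝓕 (raise F)) rF∈)))
        from : Movable F × weight F ≡ s → Ambiguous 𝓕 F
        from (mF , w≡s) = mF ,
          ¬-not (λ F∈ → 1+n≰n (subst (suc s ≤_) w≡s (Equivalence.to (in-𝓕 F) F∈))) ,
          Equivalence.from (in-𝓕 (raise F)) (≤-reflexive (sym (trans (raise-weight F mF) (cong suc w≡s))))

      ambiguous-weight : ∀ F → Ambiguous 𝓕 F → weight F ≡ s
      ambiguous-weight F = proj₂ ∘ Equivalence.to (ambiguous⇔ F)

      complement-size : ∀ F → Ambiguous 𝓕 F → count (T ∖ lookup F) ≡ suc r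
      complement-size F amb = +-cancelˡ-≡ s _ _ (begin
        s + count (T ∖ lookup F)        ≡⟨ cong (_+ count (T ∖ lookup F)) (ambiguous-weight F amb) ⟨
        weight F + count (T ∖ lookup F) ≡⟨ count-split T (lookup F) ⟨
        count T                         ≡⟨ count-T ⟩
        t + 2 * r                       ≡⟨ split-size t₁ r ⟩
        s + suc r                       ∎)
        where open ≡-Reasoning

      core-size : ∀ F Z → Ambiguous 𝓕 F → T ∖ lookup F ⊆ Z → Z ⊆ T → count Z ≡ t + r →
        count (Z ⊓ lookup F) ≡ t₁
      core-size F Z amb T∖F⊆Z Z⊆T #Z = +-cancelʳ-≡ (suc r) _ _ (begin
        count (Z ⊓ lookup F) + suc r                ≡⟨ cong (count (Z ⊓ lookup F) +_) (complement-size F amb) ⟨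
        count (Z ⊓ lookup F) + count (T ∖ lookup F) ≡⟨ cong (count (Z ⊓ lookup F) +_)
                                                        (count-cong (difference-pinned (lookup F) T∖F⊆Z Z⊆T)) ⟨
        count (Z ⊓ lookup F) + count (Z ∖ lookup F) ≡⟨ count-split Z (lookup F) ⟨
        count Z                                     ≡⟨ #Z ⟩
        t + r                                       ≡⟨ +-suc t₁ r ⟨
        t₁ + suc r                                  ∎)
        where open ≡-Reasoning

      uncommon : Subset n → Subset n → Pred n
      uncommon F H = T ∖ (lookup F ⊓ lookup H)

      -- T ∖ (F ∩ H) consists of T ∖ F (r + 1 points) and the points of T ∩ F missing in H
      uncommon-size : ∀ F H → Ambiguous 𝓕 F → count (uncommon F H) ≡ distance F H + suc r
      uncommon-size F H amb = begin
        count U                             ≡⟨ count-split U (lookup F) ⟩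
        count (U ⊓ lookup F) + count (U ∖ lookup F)
          ≡⟨ cong₂ _+_ (count-cong (λ k → inside-F (T k) (lookup F k) (lookup H k)))
                       (count-cong (λ k → outside-F (T k) (lookup F k) (lookup H k))) ⟩
        distance F H + count (T ∖ lookup F) ≡⟨ cong (distance F H +_) (complement-size F amb) ⟩
        distance F H + suc r                ∎
        where
        open ≡-Reasoning
        U : Pred n
        U = uncommon F H
        inside-F : ∀ a b c → (a ∧ not (b ∧ c)) ∧ b ≡ (a ∧ b) ∧ not (a ∧ c)
        inside-F true  true  c = ∧-identityʳ (not c)
        inside-F true  false c = refl
        inside-F false b     c = refl
        outside-F : ∀ a b c → (a ∧ not (b ∧ c)) ∧ not b ≡ a ∧ not b
        outside-F true  true  c = ∧-zeroʳ (not c)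
        outside-F true  false c = refl
        outside-F false b     c = refl

      common-core : ∀ F H → Ambiguous 𝓕 F → distance F H < t →
        ∃ λ Z → T ∖ lookup F ⊆ Z × T ∖ lookup H ⊆ Z × Z ⊆ T × count Z ≡ t + r
      common-core F H amb close
        with count-between (uncommon F H) T (t + r) (λ k → proj₁ ∘ Equivalence.to ∧-⇔) small large
        where
        small : count (uncommon F H) ≤ t + r
        small = subst (_≤ t + r) (sym (uncommon-size F H amb))
                  (subst (_≤ t + r) (sym (+-suc (distance F H) r)) (+-monoˡ-≤ r close))
        large : t + r ≤ count T
        large = subst (t + r ≤_) (sym count-T) (+-monoʳ-≤ t (m≤m+n r (r + 0)))
      ... | Z , U⊆Z , Z⊆T , #Z =
        Z , (λ k e → U⊆Z k (missing-F (T k) (lookup F k) (lookup H k) e)) ,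
            (λ k e → U⊆Z k (missing-H (T k) (lookup F k) (lookup H k) e)) , Z⊆T , #Z
        where
        missing-F : ∀ a b c → a ∧ not b ≡ true → a ∧ not (b ∧ c) ≡ true
        missing-F true false c _ = refl
        missing-H : ∀ a b c → a ∧ not c ≡ true → a ∧ not (b ∧ c) ≡ true
        missing-H true true  false _ = refl
        missing-H true false false _ = refl

      link : ∀ F H → Ambiguous 𝓕 F → Ambiguous 𝓕 H → distance F H < t →
        ∃ λ K → Ambiguous 𝓕 K × ∣ F ∩ raise K ∣ < t × ∣ H ∩ raise K ∣ < t
      link F H ambF ambH close with common-core F H ambF close
      ... | Z , T∖F⊆Z , T∖H⊆Z , Z⊆T , #Z =
        lower Z′ , ambK , crossed F ambF T∖F⊆Z , crossed H ambH T∖H⊆Z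
        where
        open ≡-Reasoning
        Z′ : Subset n
        Z′ = tabulate Z
        raised-core : raise (lower Z′) ≡ Z′
        raised-core = raise-lower Z′
          (trans (lookup∘tabulate Z i) (T∖F⊆Z i (cong₂ (λ a b → a ∧ not b) Ti (proj₁ (proj₁ ambF)))))
          (trans (lookup∘tabulate Z j) (¬-not (λ Zj → true≢false (trans (sym (Z⊆T j Zj)) Tj))))
        ambK : Ambiguous 𝓕 (lower Z′)
        ambK = Equivalence.from (ambiguous⇔ (lower Z′)) (lower-movable Z′ , suc-injective (begin
          suc (weight (lower Z′))   ≡⟨ raise-weight (lower Z′) (lower-movable Z′) ⟨
          weight (raise (lower Z′)) ≡⟨ cong weight raised-core ⟩
          weight Z′                 ≡⟨ count-cong (λ k → trans (cong (T k ∧_) (lookup∘tabulate Z k))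
                                                             (meet-superset Z⊆T k)) ⟩
          count Z                   ≡⟨ #Z ⟩
          suc s                     ∎))
        crossed : ∀ G → Ambiguous 𝓕 G → T ∖ lookup G ⊆ Z → ∣ G ∩ raise (lower Z′) ∣ < t
        crossed G ambG T∖G⊆Z = s≤s (≤-reflexive (begin
          ∣ G ∩ raise (lower Z′) ∣      ≡⟨ cong (λ V → ∣ G ∩ V ∣) raised-core ⟩
          ∣ G ∩ Z′ ∣                    ≡⟨ card-∩ G Z′ ⟩
          count (lookup G ⊓ lookup Z′) ≡⟨ count-cong (λ k → trans (cong (lookup G k ∧_) (lookup∘tabulate Z k))
                                                                   (∧-comm (lookup G k) (Z k))) ⟩
          count (Z ⊓ lookup G)          ≡⟨ core-size G Z ambG T∖G⊆Z Z⊆T #Z ⟩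
          t₁                            ∎))

      module Exchange {F H : Subset n} (ambF : Ambiguous 𝓕 F) (ambH : Ambiguous 𝓕 H) {a b : Fin n}
                      (a∈ : (trace F ∖ trace H) a ≡ true) (b∈ : (trace H ∖ trace F) b ≡ true) where

        H′ : Subset n
        H′ = replace H a b

        private
          point : ∀ x y z → (x ∧ y) ∧ not (x ∧ z) ≡ true → x ≡ true × y ≡ true × z ≡ false
          point true true false _ = refl , refl , refl

          a-facts : T a ≡ true × lookup F a ≡ true × lookup H a ≡ false
          a-facts = point (T a) (lookup F a) (lookup H a) a∈

          b-facts : T b ≡ true × lookup H b ≡ true × lookup F b ≡ false
          b-facts = point (T b) (lookup H b) (lookup F b) b∈

          a≢b : ¬ a ≡ b
          a≢b = apart (lookup F) (proj₁ (proj₂ a-facts)) (proj₂ (proj₂ b-facts))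

          trace-a : trace H′ a ≡ true
          trace-a = trans (cong (T a ∧_) (replace-a H)) (trans (∧-identityʳ (T a)) (proj₁ a-facts))

          trace-b : trace H′ b ≡ false
          trace-b = trans (cong (T b ∧_) (replace-b H a≢b)) (∧-zeroʳ (T b))

          trace-other : ∀ k → ¬ k ≡ a → ¬ k ≡ b → trace H′ k ≡ trace H k
          trace-other k k≢a k≢b = cong (T k ∧_) (replace-other H k≢a k≢b)

        -- H′ is movable (a, b ∉ {i, j}) and has the same T-weight as H
        exchanged-ambiguous : Ambiguous 𝓕 H′
        exchanged-ambiguous with Equivalence.to (ambiguous⇔ H) ambH
        ... | (Hi , Hj) , wH = Equivalence.from (ambiguous⇔ H′) (movable , trans (sym same-weight) wH)
          where
          movable : Movable H′
          movable =
            trans (replace-other H (apart (lookup F) (proj₁ (proj₂ a-facts)) (proj₁ (proj₁ ambF)) ∘ sym)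
                                   (apart (lookup H) (proj₁ (proj₂ b-facts)) Hi ∘ sym)) Hi ,
            trans (replace-other H (apart T (proj₁ a-facts) Tj ∘ sym) (apart T (proj₁ b-facts) Tj ∘ sym)) Hj
          same-weight : weight H ≡ weight H′
          same-weight = count-exchange a b (λ k k≢a k≢b → sym (trace-other k k≢a k≢b))
            (trans (cong (T a ∧_) (proj₂ (proj₂ a-facts))) (∧-zeroʳ (T a))) trace-a
            (trans (cong (T b ∧_) (proj₁ (proj₂ b-facts))) (trans (∧-identityʳ (T b)) (proj₁ b-facts))) trace-b

        -- H′ gains the point a of F, and the point b it loses is not in F
        exchanged-closer : distance F H ≡ suc (distance F H′)
        exchanged-closer = trans (count-delete a agree gone) (cong (λ x → bit x + distance F H′) a∈)
          where
          F-b : trace F b ≡ false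
          F-b = trans (cong (T b ∧_) (proj₂ (proj₂ b-facts))) (∧-zeroʳ (T b))
          agree : ∀ k → ¬ k ≡ a → (trace F ∖ trace H) k ≡ (trace F ∖ trace H′) k
          agree k k≢a with k ≟ b
          ... | yes refl = trans (cong (_∧ not (trace H k)) F-b) (sym (cong (_∧ not (trace H′ k)) F-b))
          ... | no k≢b   = cong (λ x → trace F k ∧ not x) (sym (trace-other k k≢a k≢b))
          gone : (trace F ∖ trace H′) a ≡ false
          gone = trans (cong (λ x → trace F a ∧ not x) trace-a) (∧-zeroʳ (trace F a))

        -- the only point of T that H′ has and H lacks is a
        exchanged-near : distance H′ H ≤ 1
        exchanged-near = subst (_≤ 1) (sym (begin
          distance H′ H                   ≡⟨ count-delete a only-a refl ⟩
          bit at-a + count {n} (λ _ → false) ≡⟨ cong (bit at-a +_) (count-empty n) ⟩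
          bit at-a + 0                    ≡⟨ +-identityʳ (bit at-a) ⟩
          bit at-a                        ∎)) (bit≤1 at-a)
          where
          open ≡-Reasoning
          at-a : Bool
          at-a = (trace H′ ∖ trace H) a
          only-a : ∀ k → ¬ k ≡ a → (trace H′ ∖ trace H) k ≡ false
          only-a k k≢a with k ≟ b
          ... | yes refl = cong (_∧ not (trace H k)) trace-b
          ... | no k≢b   = trans (cong (_∧ not (trace H k)) (trace-other k k≢a k≢b)) (∧-inverseʳ (trace H k))

      exchange : ∀ F H m → Ambiguous 𝓕 F → Ambiguous 𝓕 H → distance F H ≡ suc m →
        ∃ λ H′ → Ambiguous 𝓕 H′ × distance F H′ ≡ m × distance H′ H ≤ 1
      exchange F H m ambF ambH d≡1+m
        with count-witness (trace F ∖ trace H) (subst (0 <_) (sym d≡1+m) (s≤s z≤n))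
           | count-witness (trace H ∖ trace F) (subst (0 <_) (sym (trans (sym balanced) d≡1+m)) (s≤s z≤n))
        where
        balanced : distance F H ≡ distance H F
        balanced = count-balance (trace F) (trace H)
          (trans (ambiguous-weight F ambF) (sym (ambiguous-weight H ambH)))
      ... | a , a∈ | b , b∈ =
        H′ , exchanged-ambiguous , suc-injective (trans (sym exchanged-closer) d≡1+m) , exchanged-near
        where open Exchange {F} {H} ambF ambH {a} {b} a∈ b∈

      module Constant (1≤t₁ : 1 ≤ t₁) {X Y : Family n}
                      (X↦𝓕 : ∀ G → InShift i j X G ⇔ G ∈ᶠ 𝓕) (Y↦𝓕 : ∀ G → InShift i j Y G ⇔ G ∈ᶠ 𝓕)
                      (cross : CrossIntersecting t X Y) where

        linked-agree : ∀ F H → Ambiguous 𝓕 F → Ambiguous 𝓕 H → distance F H < t → X F ≡ X H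
        linked-agree F H ambF ambH close = through (link F H ambF ambH close)
          where
          through : (∃ λ K → Ambiguous 𝓕 K × ∣ F ∩ raise K ∣ < t × ∣ H ∩ raise K ∣ < t) → X F ≡ X H
          through (K , ambK , FK , HK) =
            trans (relay t X↦𝓕 Y↦𝓕 cross ambF ambK FK) (sym (relay t X↦𝓕 Y↦𝓕 cross ambH ambK HK))

        -- induction on the distance, one exchange at a time (needs t ≥ 2)
        walk : ∀ m F H → Ambiguous 𝓕 F → Ambiguous 𝓕 H → distance F H ≡ m → X F ≡ X H
        walk zero F H ambF ambH d≡0 = linked-agree F H ambF ambH (subst (_< t) (sym d≡0) (s≤s z≤n))
        walk (suc m) F H ambF ambH d≡1+m = through (exchange F H m ambF ambH d≡1+m)
          where
          through : (∃ λ H′ → Ambiguous 𝓕 H′ × distance F H′ ≡ m × distance H′ H ≤ 1) → X F ≡ X H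
          through (H′ , ambH′ , d′≡m , near) =
            trans (walk m F H′ ambF ambH′ d′≡m) (linked-agree H′ H ambH′ ambH (≤-<-trans near (s≤s 1≤t₁)))

        constant : ∀ F H → Ambiguous 𝓕 F → Ambiguous 𝓕 H → X F ≡ X H
        constant F H ambF ambH = walk _ F H ambF ambH refl

      shared-choice : 1 ≤ t₁ → ∀ {A B} →
        (∀ G → InShift i j A G ⇔ G ∈ᶠ 𝓕) → (∀ G → InShift i j B G ⇔ G ∈ᶠ 𝓕) → CrossIntersecting t A B →
        ∀ F₀ → Ambiguous 𝓕 F₀ → (∀ F → Ambiguous 𝓕 F → A F ≡ A F₀) × (∀ F → Ambiguous 𝓕 F → B F ≡ A F₀)
      shared-choice 1≤t₁ {A} {B} A↦𝓕 B↦𝓕 cross F₀ amb₀ =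
        (λ F amb → Constant.constant 1≤t₁ A↦𝓕 B↦𝓕 cross F F₀ amb amb₀) ,
        through (link F₀ F₀ amb₀ amb₀ (subst (_< t) (sym (self-distance F₀)) (s≤s z≤n)))
        where
        through : (∃ λ K → Ambiguous 𝓕 K × ∣ F₀ ∩ raise K ∣ < t × ∣ F₀ ∩ raise K ∣ < t) →
          ∀ F → Ambiguous 𝓕 F → B F ≡ A F₀
        through (K , ambK , F₀K , _) F amb =
          trans (Constant.constant 1≤t₁ B↦𝓕 A↦𝓕 (cross-sym cross) F K amb ambK)
                (sym (relay t A↦𝓕 B↦𝓕 cross amb₀ ambK F₀K))

    orientation : 1 ≤ t₁ → ∀ {A B} →
      (∀ G → InShift i j A G ⇔ G ∈ᶠ 𝓕) → (∀ G → InShift i j B G ⇔ G ∈ᶠ 𝓕) → CrossIntersecting t A B →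
      ∃ λ o → (∀ F → Ambiguous 𝓕 F → A F ≡ o) × (∀ F → Ambiguous 𝓕 F → B F ≡ o)
    orientation 1≤t₁ {A} {B} A↦𝓕 B↦𝓕 cross with anySubset? (ambiguous? 𝓕)
    ... | no none = false , (λ F amb → ⊥-elim (none (F , amb))) , (λ F amb → ⊥-elim (none (F , amb)))
    ... | yes (F₀ , amb₀) = A F₀ , Ends.shared-choice Ti Tj 1≤t₁ A↦𝓕 B↦𝓕 cross F₀ amb₀
      where
      Ti : T i ≡ true
      Ti = proj₁ (ambiguous-ends F₀ amb₀)
      Tj : T j ≡ false
      Tj = proj₂ (ambiguous-ends F₀ amb₀)

lemma2p5 : (t r n : ℕ) → 2 ≤ t → t + 2 * r ≤ n →
    (𝓐 𝓑 : Family n) → CrossIntersecting t 𝓐 𝓑 →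
    (i j : Fin n) → i <ᶠ j →
    (∀ G → InShift i j 𝓐 G ⇔ InF n t r G) →
    (∀ G → InShift i j 𝓑 G ⇔ InF n t r G) →
    (𝓐 ≐ 𝓑) × Isomorphic 𝓐 (InF n t r)
lemma2p5 (suc t₁) r n (s≤s 1≤t₁) size 𝓐 𝓑 cross i j i<j 𝓐↦F 𝓑↦F =
  (λ H → trans (𝓐-twisted H) (sym (𝓑-twisted H))) ,
  isomorphic-via (twist o) (λ H → ⇔.trans (mk⇔ (trans (sym (𝓐-twisted H))) (trans (𝓐-twisted H)))
                                          (⇔.sym (InF⇔𝓕 (permImage (flip (twist o)) H))))
  where
  open Segment t₁ r n size
  open Shifting i j (Fin.<⇒≢ i<j)
  open AtPair i j (Fin.<⇒≢ i<j)
  𝓐↦𝓕 : ∀ G → InShift i j 𝓐 G ⇔ G ∈ᶠ 𝓕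
  𝓐↦𝓕 G = ⇔.trans (𝓐↦F G) (InF⇔𝓕 G)
  𝓑↦𝓕 : ∀ G → InShift i j 𝓑 G ⇔ G ∈ᶠ 𝓕
  𝓑↦𝓕 G = ⇔.trans (𝓑↦F G) (InF⇔𝓕 G)
  choice : ∃ λ o → (∀ F → Ambiguous 𝓕 F → 𝓐 F ≡ o) × (∀ F → Ambiguous 𝓕 F → 𝓑 F ≡ o)
  choice = orientation 1≤t₁ 𝓐↦𝓕 𝓑↦𝓕 cross
  o : Bool
  o = proj₁ choice
  𝓐-twisted : ∀ H → 𝓐 H ≡ 𝓕 (permImage (flip (twist o)) H)
  𝓐-twisted = Shifted.reconstruct 𝓐 𝓕 𝓐↦𝓕 o (proj₁ (proj₂ choice))
  𝓑-twisted : ∀ H → 𝓑 H ≡ 𝓕 (permImage (flip (twist o)) H)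
  𝓑-twisted = Shifted.reconstruct 𝓑 𝓕 𝓑↦𝓕 o (proj₂ (proj₂ choice))
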